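{- There exists a planar oriented graph $D$ with the following property: for every minimum feedback arc set $F$ of $D$ and every vertex cover $Y$ of $F$, the subdigraph of $D$ induced by $Y$ contains a directed cycle.
   Context: An oriented graph is a directed graph with no loops in which any pair of vertices is joined by at most one arc. It is planar if its underlying undirected graph is planar. A feedback arc set of a digraph is a set of arcs whose removal leaves a digraph with no directed cycle; a minimum feedback arc set is one of minimum cardinality. A vertex cover of a set $F$ of arcs is a set $Y$ of vertices such that every arc in $F$ has at least one endpoint in $Y$. -}

module Defs where

open import Data.Nat using (ℕ; zero; suc; _≤_; _<_)
open import Data.Fin using (Fin)
open import Data.Fin.Subset using (Subset; _∈_)
open import Data.Bool using (Bool; true; false)
open import Data.Product using (Σ; _×_; _,_; ∃)
open import Data.Sum using (_⊎_)
open import Data.List using (List; []; _∷_; length)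
open import Data.List.Relation.Unary.All using (All)
open import Data.List.Relation.Unary.Unique.Propositional using (Unique)
import Data.List.Membership.Propositional as LM
open import Data.Empty using (⊥)
open import Relation.Nullary using (¬_)
open import Relation.Binary.PropositionalEquality using (_≡_; _≢_)
open import Data.Rational as Q using (ℚ; 0ℚ; 1ℚ)

-- Digraphs on vertex set Fin n: arc relation given as a Boolean matrix.
-- A simple relation automatically has at most one arc u→v.

record Digraph : Set where
  field
    n   : ℕ
    arc : Fin n → Fin n → Bool

open Digraph public

Arc : (D : Digraph) → Fin (n D) → Fin (n D) → Set
Arc D u v = arc D u v ≡ true

IsOriented : Digraph → Set
IsOriented D = (∀ u → ¬ Arc D u u) × (∀ u v → Arc D u v → ¬ Arc D v u)

-- Directed cycles in an arbitrary arc relation R on Fin m: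
-- a nonempty list of distinct vertices v₀ … v_{k-1} with arcs
-- vᵢ → vᵢ₊₁ and v_{k-1} → v₀.

data PathBack {m : ℕ} (R : Fin m → Fin m → Set) (first : Fin m) : Fin m → List (Fin m) → Set where
  close : ∀ {v} → R v first → PathBack R first v []
  step  : ∀ {v w ws} → R v w → PathBack R first w ws → PathBack R first v (w ∷ ws)

HasDirectedCycle : {m : ℕ} → (Fin m → Fin m → Set) → Set
HasDirectedCycle {m} R =
  Σ (Fin m) λ v → Σ (List (Fin m)) λ vs → Unique (v ∷ vs) × PathBack R v v vs

-- Arc sets: duplicate-free lists of arcs of D; cardinality = length.

ArcPair : Digraph → Set
ArcPair D = Fin (n D) × Fin (n D)

IsArcSet : (D : Digraph) → List (ArcPair D) → Set
IsArcSet D F = Unique F × All (λ { (u , v) → Arc D u v }) F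

ArcMinus : (D : Digraph) → List (ArcPair D) → Fin (n D) → Fin (n D) → Set
ArcMinus D F u v = Arc D u v × ¬ (LM._∈_ (u , v) F)

IsFeedbackArcSet : (D : Digraph) → List (ArcPair D) → Set
IsFeedbackArcSet D F = IsArcSet D F × ¬ HasDirectedCycle (ArcMinus D F)

IsMinimumFAS : (D : Digraph) → List (ArcPair D) → Set
IsMinimumFAS D F = IsFeedbackArcSet D F ×
  (∀ F' → IsFeedbackArcSet D F' → length F ≤ length F')

IsVertexCover : (D : Digraph) → Subset (n D) → List (ArcPair D) → Set
IsVertexCover D Y F = All (λ { (u , v) → (u ∈ Y) ⊎ (v ∈ Y) }) F

InducedArc : (D : Digraph) → Subset (n D) → Fin (n D) → Fin (n D) → Set
InducedArc D Y u v = (u ∈ Y) × (v ∈ Y) × Arc D u v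

-- Planarity of the underlying undirected graph, via a crossing-free
-- straight-line drawing with rational coordinates.

Point : Set
Point = ℚ × ℚ

along : Point → Point → ℚ → Point
along (px , py) (qx , qy) s = (px Q.+ s Q.* (qx Q.- px)) , (py Q.+ s Q.* (qy Q.- py))

InUnit : ℚ → Set
InUnit s = (0ℚ Q.≤ s) × (s Q.≤ 1ℚ)

OnSegment : Point → Point → Point → Set
OnSegment x p q = Σ ℚ λ s → InUnit s × (x ≡ along p q s)

SegmentsMeet : Point → Point → Point → Point → Set
SegmentsMeet p q r t = Σ Point λ x → OnSegment x p q × OnSegment x r t

Edge : (D : Digraph) → Fin (n D) → Fin (n D) → Set
Edge D u v = Arc D u v ⊎ Arc D v u

record PlanarDrawing (D : Digraph) : Set where
  field
    pos       : Fin (n D) → Point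
    injective : ∀ u v → pos u ≡ pos v → u ≡ v
    vertexOff : ∀ u v w → Edge D u v → w ≢ u → w ≢ v →
                ¬ OnSegment (pos w) (pos u) (pos v)
    disjoint  : ∀ u v u' v' → Edge D u v → Edge D u' v' →
                u ≢ u' → u ≢ v' → v ≢ u' → v ≢ v' →
                ¬ SegmentsMeet (pos u) (pos v) (pos u') (pos v')

IsPlanar : Digraph → Set
IsPlanar D = PlanarDrawing D

{-# OPTIONS --safe #-}
-- D has a core on the vertices 0–5 and nine more vertices, each the middle of a path of
-- length two between core vertices. Ranking the core 0 < 1 < … < 5, every arc climbs
-- except seven forced core arcs, which therefore form a feedback arc set. Each forced
-- arc a → b closes a triangle with a path b → x → a and lies on a second (detour) cycle;
-- without that arc these two cycles and the other six triangles are pairwise arc-disjoint,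
-- so a feedback arc set omitting it has at least eight arcs. Hence a minimum feedback arc
-- set contains all forced arcs, and checking the 64 subsets of the core shows that a
-- vertex cover of the forced arcs contains one of four triangles of the core.
-- Planarity is certified by an integer straight-line drawing in which every edge is
-- separated from every vertex off it and every edge disjoint from it by a line.
module Submission where

open import Defs
open import Data.Product using (Σ; _×_)
open import Data.List using (List)
open import Data.Fin.Subset using (Subset)
open import Data.Fin.Subset using () renaming (_∈_ to _∈ₛ_)

open import Function using (_∘_)
open import Data.Empty using (⊥-elim)
open import Data.Product using (_,_; proj₁; proj₂)
open import Data.Product.Properties using (≡-dec)
open import Data.Sum using (_⊎_; inj₁; inj₂; [_,_])
open import Data.Bool using (true)
import Data.Bool.Properties as Bool
open import Data.Nat as ℕ using (ℕ)
import Data.Nat.Properties as ℕ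
open import Data.Integer as ℤ using (ℤ; +_; 0ℤ; 1ℤ)
import Data.Integer.Properties as ℤ
open import Data.Rational as ℚ using (ℚ; 0ℚ; 1ℚ; _+_; _*_; _-_; _≤_)
import Data.Rational.Properties as ℚ
open import Data.Rational.Literals using (fromℤ)
open import Data.Rational.Solver using (module +-*-Solver)
open import Data.Fin as Fin using (Fin; zero; suc; #_)
import Data.Fin.Properties as Fin
open import Data.Fin.Subset.Properties using (anySubset?) renaming (_∈?_ to _∈ₛ?_)
open import Data.Vec as Vec using (_∷_; []; _++_)
open import Data.List as List using ([]; _∷_; length; tabulate; concatMap)
open import Data.List.Relation.Unary.All as All using (All; []; _∷_)
open import Data.List.Relation.Unary.Any as Any using (Any)
import Data.List.Relation.Unary.All.Properties as AllP
open import Data.List.Relation.Unary.Unique.Propositional using (Unique)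
import Data.List.Relation.Unary.Unique.DecPropositional as Unique
open import Data.List.Relation.Binary.Disjoint.Propositional using (Disjoint)
open import Data.List.Relation.Binary.Disjoint.DecPropositional using (disjoint?)
open import Data.List.Membership.Propositional using (_∈_; _∉_; find)
open import Data.List.Membership.Setoid.Properties using (index-injective)
open import Relation.Nullary using (¬_; Dec; yes; no)
open import Relation.Nullary.Decidable
  using (isYes; toWitness; from-yes; decidable-stable; ¬?; _×-dec_; _⊎-dec_; _→-dec_)
open import Relation.Binary using (Decidable; DecidableEquality)
open import Relation.Binary.PropositionalEquality
  using (_≡_; _≢_; refl; sym; trans; cong; cong₂; subst; subst₂; setoid; module ≡-Reasoning)
open import Function.Bundles using (Equivalence)
open +-*-Solver using (solve; _:+_; _:*_; _:-_; _:=_; con)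

Line : Set
Line = ℚ × ℚ × ℚ

ev : Line → Point → ℚ
ev (a , b , c) (x , y) = a * x + b * y + c

ev-along : ∀ L p q s → ev L (along p q s) ≡ (1ℚ - s) * ev L p + s * ev L q
ev-along (a , b , c) (px , py) (qx , qy) s =
  solve 8 (λ a b c px py qx qy s →
      a :* (px :+ s :* (qx :- px)) :+ b :* (py :+ s :* (qy :- py)) :+ c
    := (con 1ℚ :- s) :* (a :* px :+ b :* py :+ c) :+ s :* (a :* qx :+ b :* qy :+ c))
    refl a b c px py qx qy s

along-reverse : ∀ p q s → along q p (1ℚ - s) ≡ along p q s
along-reverse (px , py) (qx , qy) s = cong₂ _,_ (coordinate px qx) (coordinate py qy)
  where
  coordinate : ∀ x y → y + (1ℚ - s) * (x - y) ≡ x + s * (y - x)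
  coordinate = solve 3 (λ s x y → y :+ (con 1ℚ :- s) :* (x :- y) := x :+ s :* (y :- x)) refl s

along-zero : ∀ p q → along p q 0ℚ ≡ p
along-zero (px , py) (qx , qy) = cong₂ _,_ (origin px qx) (origin py qy)
  where
  origin : ∀ x y → x + 0ℚ * (y - x) ≡ x
  origin = solve 2 (λ x y → x :+ con 0ℚ :* (y :- x) := x) refl

0≤1-s : ∀ {s} → s ≤ 1ℚ → 0ℚ ≤ 1ℚ - s
0≤1-s {s} s≤1 = begin
  0ℚ          ≡⟨ sym (ℚ.+-inverseʳ 1ℚ) ⟩
  1ℚ - 1ℚ     ≤⟨ ℚ.+-monoʳ-≤ 1ℚ (ℚ.neg-antimono-≤ s≤1) ⟩
  1ℚ - s      ∎
  where open ℚ.≤-Reasoning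

1-s≤1 : ∀ {s} → 0ℚ ≤ s → 1ℚ - s ≤ 1ℚ
1-s≤1 {s} 0≤s = begin
  1ℚ - s      ≤⟨ ℚ.+-monoʳ-≤ 1ℚ (ℚ.neg-antimono-≤ 0≤s) ⟩
  1ℚ + ℚ.- 0ℚ ≡⟨ ℚ.+-identityʳ 1ℚ ⟩
  1ℚ          ∎
  where open ℚ.≤-Reasoning

InUnit-reverse : ∀ {s} → InUnit s → InUnit (1ℚ - s)
InUnit-reverse (0≤s , s≤1) = 0≤1-s s≤1 , 1-s≤1 0≤s

OnSegment-reverse : ∀ {x p q} → OnSegment x p q → OnSegment x q p
OnSegment-reverse {p = p} {q} (s , s∈I , refl) = 1ℚ - s , InUnit-reverse s∈I , sym (along-reverse p q s)

OnSegment-start : ∀ p q → OnSegment p p q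
OnSegment-start p q = 0ℚ , (ℚ.≤-refl , ℚ.nonNegative⁻¹ 1ℚ) , sym (along-zero p q)

SegmentsMeet-reverseˡ : ∀ {p q r t} → SegmentsMeet p q r t → SegmentsMeet q p r t
SegmentsMeet-reverseˡ {p} {q} (x , x∈pq , x∈rt) = x , OnSegment-reverse {p = p} {q} x∈pq , x∈rt

SegmentsMeet-reverseʳ : ∀ {p q r t} → SegmentsMeet p q r t → SegmentsMeet p q t r
SegmentsMeet-reverseʳ {r = r} {t} (x , x∈pq , x∈rt) = x , x∈pq , OnSegment-reverse {p = r} {t} x∈rt

SegmentsMeet-swap : ∀ {p q r t} → SegmentsMeet p q r t → SegmentsMeet r t p q
SegmentsMeet-swap (x , x∈pq , x∈rt) = x , x∈rt , x∈pq

convex-≤ : ∀ {k a b s} → InUnit s → a ≤ k → b ≤ k → (1ℚ - s) * a + s * b ≤ k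
convex-≤ {k} {a} {b} {s} (0≤s , s≤1) a≤k b≤k = begin
  (1ℚ - s) * a + s * b ≤⟨ ℚ.+-mono-≤ (ℚ.*-monoˡ-≤-nonNeg (1ℚ - s) {{ℚ.nonNegative (0≤1-s s≤1)}} a≤k)
                                     (ℚ.*-monoˡ-≤-nonNeg s {{ℚ.nonNegative 0≤s}} b≤k) ⟩
  (1ℚ - s) * k + s * k ≡⟨ solve 2 (λ k s → (con 1ℚ :- s) :* k :+ s :* k := k) refl k s ⟩
  k                    ∎
  where open ℚ.≤-Reasoning

convex-≥ : ∀ {k a b s} → InUnit s → k ≤ a → k ≤ b → k ≤ (1ℚ - s) * a + s * b
convex-≥ {k} {a} {b} {s} (0≤s , s≤1) k≤a k≤b = begin
  k                    ≡⟨ solve 2 (λ k s → k := (con 1ℚ :- s) :* k :+ s :* k) refl k s ⟩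
  (1ℚ - s) * k + s * k ≤⟨ ℚ.+-mono-≤ (ℚ.*-monoˡ-≤-nonNeg (1ℚ - s) {{ℚ.nonNegative (0≤1-s s≤1)}} k≤a)
                                     (ℚ.*-monoˡ-≤-nonNeg s {{ℚ.nonNegative 0≤s}} k≤b) ⟩
  (1ℚ - s) * a + s * b ∎
  where open ℚ.≤-Reasoning

Separates : Line → Point → Point → Point → Point → Set
Separates L p q r t = (ev L p ≤ 0ℚ × ev L q ≤ 0ℚ) × (1ℚ ≤ ev L r × 1ℚ ≤ ev L t)

OnSegment-below : ∀ L {k x p q} → OnSegment x p q → ev L p ≤ k → ev L q ≤ k → ev L x ≤ k
OnSegment-below L {p = p} {q} (s , s∈I , refl) Lp≤k Lq≤k =
  subst (_≤ _) (sym (ev-along L p q s)) (convex-≤ s∈I Lp≤k Lq≤k)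

OnSegment-above : ∀ L {k x p q} → OnSegment x p q → k ≤ ev L p → k ≤ ev L q → k ≤ ev L x
OnSegment-above L {p = p} {q} (s , s∈I , refl) k≤Lp k≤Lq =
  subst (_ ≤_) (sym (ev-along L p q s)) (convex-≥ s∈I k≤Lp k≤Lq)

separated⇒¬meet : ∀ {L p q r t} → Separates L p q r t → ¬ SegmentsMeet p q r t
separated⇒¬meet {L} ((Lp≤0 , Lq≤0) , (1≤Lr , 1≤Lt)) (x , x∈pq , x∈rt) =
  ℚ.<-irrefl refl (ℚ.<-≤-trans (ℚ.positive⁻¹ 1ℚ) 1≤0)
  where
  1≤0 : 1ℚ ≤ 0ℚ
  1≤0 = ℚ.≤-trans (OnSegment-above L x∈rt 1≤Lr 1≤Lt) (OnSegment-below L x∈pq Lp≤0 Lq≤0)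

PointZ : Set
PointZ = ℤ × ℤ

LineZ : Set
LineZ = ℤ × ℤ × ℤ

evZ : LineZ → PointZ → ℤ
evZ (a , b , c) (x , y) = a ℤ.* x ℤ.+ b ℤ.* y ℤ.+ c

toPoint : PointZ → Point
toPoint (x , y) = fromℤ x , fromℤ y

toLine : LineZ → Line
toLine (a , b , c) = fromℤ a , fromℤ b , fromℤ c

fromℤ-injective : ∀ {a b} → fromℤ a ≡ fromℤ b → a ≡ b
fromℤ-injective = cong ℚ.↥_

fromℤ-+ : ∀ a b → fromℤ a + fromℤ b ≡ fromℤ (a ℤ.+ b)
fromℤ-+ a b = trans (cong (ℚ._/ 1) (cong₂ ℤ._+_ (ℤ.*-identityʳ a) (ℤ.*-identityʳ b)))
                    (ℚ.↥p/↧p≡p (fromℤ (a ℤ.+ b)))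

fromℤ-* : ∀ a b → fromℤ a * fromℤ b ≡ fromℤ (a ℤ.* b)
fromℤ-* a b = ℚ.↥p/↧p≡p (fromℤ (a ℤ.* b))

fromℤ-mono-≤ : ∀ {a b} → a ℤ.≤ b → fromℤ a ≤ fromℤ b
fromℤ-mono-≤ {a} {b} a≤b = ℚ.*≤* (subst₂ ℤ._≤_ (sym (ℤ.*-identityʳ a)) (sym (ℤ.*-identityʳ b)) a≤b)

ev-toLine : ∀ L p → ev (toLine L) (toPoint p) ≡ fromℤ (evZ L p)
ev-toLine (a , b , c) (x , y) = begin
  fromℤ a * fromℤ x + fromℤ b * fromℤ y + fromℤ c
    ≡⟨ cong₂ (λ u v → u + v + fromℤ c) (fromℤ-* a x) (fromℤ-* b y) ⟩
  fromℤ (a ℤ.* x) + fromℤ (b ℤ.* y) + fromℤ c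
    ≡⟨ cong (_+ fromℤ c) (fromℤ-+ (a ℤ.* x) (b ℤ.* y)) ⟩
  fromℤ (a ℤ.* x ℤ.+ b ℤ.* y) + fromℤ c
    ≡⟨ fromℤ-+ (a ℤ.* x ℤ.+ b ℤ.* y) c ⟩
  fromℤ (a ℤ.* x ℤ.+ b ℤ.* y ℤ.+ c) ∎
  where open ≡-Reasoning

SeparatesZ : LineZ → PointZ → PointZ → PointZ → PointZ → Set
SeparatesZ L p q r t = (evZ L p ℤ.≤ 0ℤ × evZ L q ℤ.≤ 0ℤ) × (1ℤ ℤ.≤ evZ L r × 1ℤ ℤ.≤ evZ L t)

separatesZ? : ∀ L p q r t → Dec (SeparatesZ L p q r t)
separatesZ? L p q r t =
  ((evZ L p ℤ.≤? 0ℤ) ×-dec (evZ L q ℤ.≤? 0ℤ)) ×-dec ((1ℤ ℤ.≤? evZ L r) ×-dec (1ℤ ℤ.≤? evZ L t))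

SeparatesZ⇒¬meet : ∀ L p q r t → SeparatesZ L p q r t →
                   ¬ SegmentsMeet (toPoint p) (toPoint q) (toPoint r) (toPoint t)
SeparatesZ⇒¬meet L p q r t ((Lp≤0 , Lq≤0) , (1≤Lr , 1≤Lt)) =
  separated⇒¬meet {toLine L} {toPoint p} {toPoint q} {toPoint r} {toPoint t}
    ((below p Lp≤0 , below q Lq≤0) , (above r 1≤Lr , above t 1≤Lt))
  where
  below : ∀ x → evZ L x ℤ.≤ 0ℤ → ev (toLine L) (toPoint x) ≤ 0ℚ
  below x h = subst (_≤ 0ℚ) (sym (ev-toLine L x)) (fromℤ-mono-≤ h)
  above : ∀ x → 1ℤ ℤ.≤ evZ L x → 1ℚ ≤ ev (toLine L) (toPoint x)
  above x h = subst (1ℚ ≤_) (sym (ev-toLine L x)) (fromℤ-mono-≤ h)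

lineThrough : PointZ → PointZ → LineZ
lineThrough (px , py) (qx , qy) = py ℤ.- qy , qx ℤ.- px , px ℤ.* qy ℤ.- py ℤ.* qx

negateLine : LineZ → LineZ
negateLine (a , b , c) = ℤ.- a , ℤ.- b , ℤ.- c

-- Separating lines are only sought among the two orientations of the line
-- through one of the segments; this suffices for the drawing used below.
SeparatedByLineThrough : PointZ → PointZ → PointZ → PointZ → Set
SeparatedByLineThrough p q r t =
  Any (λ L → SeparatesZ L p q r t) (lineThrough p q ∷ negateLine (lineThrough p q) ∷ [])

SegmentsSeparated : PointZ → PointZ → PointZ → PointZ → Set
SegmentsSeparated p q r t = SeparatedByLineThrough p q r t ⊎ SeparatedByLineThrough r t p q

segmentsSeparated? : ∀ p q r t → Dec (SegmentsSeparated p q r t)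
segmentsSeparated? p q r t = separatedByLineThrough? p q r t ⊎-dec separatedByLineThrough? r t p q
  where
  separatedByLineThrough? : ∀ p q r t → Dec (SeparatedByLineThrough p q r t)
  separatedByLineThrough? p q r t = Any.any? (λ L → separatesZ? L p q r t) _

SegmentsSeparated⇒¬meet : ∀ p q r t → SegmentsSeparated p q r t →
                          ¬ SegmentsMeet (toPoint p) (toPoint q) (toPoint r) (toPoint t)
SegmentsSeparated⇒¬meet p q r t (inj₁ sep) =
  let L , L-sep = Any.satisfied sep
  in SeparatesZ⇒¬meet L p q r t L-sep
SegmentsSeparated⇒¬meet p q r t (inj₂ sep) =
  let L , L-sep = Any.satisfied sep
  in SeparatesZ⇒¬meet L r t p q L-sep ∘ SegmentsMeet-swap {toPoint p} {toPoint q} {toPoint r} {toPoint t}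

_≟ᵃ_ : ∀ {m} → DecidableEquality (Fin m × Fin m)
_≟ᵃ_ = ≡-dec Fin._≟_ Fin._≟_

listDigraph : (m : ℕ) → List (Fin m × Fin m) → Digraph
listDigraph m arcs = record { n = m ; arc = λ u v → isYes (Any.any? ((u , v) ≟ᵃ_) arcs) }

Arc-listDigraph⇒∈ : ∀ {m arcs u v} → Arc (listDigraph m arcs) u v → (u , v) ∈ arcs
Arc-listDigraph⇒∈ = toWitness ∘ Equivalence.from Bool.T-≡

arc? : ∀ D → Decidable (Arc D)
arc? D u v = arc D u v Bool.≟ true

inducedArc? : ∀ D Y → Decidable (InducedArc D Y)
inducedArc? D Y u v = u ∈ₛ? Y ×-dec v ∈ₛ? Y ×-dec arc? D u v

Covers : ∀ {m} → Subset m → Fin m × Fin m → Set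
Covers Y (u , v) = u ∈ₛ Y ⊎ v ∈ₛ Y

covers? : ∀ {m} (Y : Subset m) e → Dec (Covers Y e)
covers? Y (u , v) = u ∈ₛ? Y ⊎-dec v ∈ₛ? Y

Edge-elim : ∀ D {P : Fin (n D) → Fin (n D) → Set} → (∀ {u v} → P u v → P v u) →
            (∀ {u v} → Arc D u v → P u v) → ∀ {u v} → Edge D u v → P u v
Edge-elim D P-sym onArc = [ onArc , P-sym ∘ onArc ]

module StraightLineDrawing {m : ℕ} (arcs : List (Fin m × Fin m)) (position : Fin m → PointZ) where

  D : Digraph
  D = listDigraph m arcs

  pos : Fin m → Point
  pos = toPoint ∘ position

  -- The vertex w is tested as the degenerate segment [w, w].
  ClearOfVertex : Fin m → Fin m × Fin m → Set
  ClearOfVertex w (u , v) = w ≡ u ⊎ w ≡ v ⊎ SegmentsSeparated (position u) (position v) (position w) (position w)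

  ClearOfEdge : Fin m × Fin m → Fin m × Fin m → Set
  ClearOfEdge (u , v) (u' , v') =
    (u ≡ u' ⊎ u ≡ v' ⊎ v ≡ u' ⊎ v ≡ v') ⊎ SegmentsSeparated (position u) (position v) (position u') (position v')

  clearOfVertex? : ∀ w e → Dec (ClearOfVertex w e)
  clearOfVertex? w (u , v) = w Fin.≟ u ⊎-dec w Fin.≟ v ⊎-dec segmentsSeparated? _ _ _ _

  clearOfEdge? : ∀ e e' → Dec (ClearOfEdge e e')
  clearOfEdge? (u , v) (u' , v') =
    (u Fin.≟ u' ⊎-dec u Fin.≟ v' ⊎-dec v Fin.≟ u' ⊎-dec v Fin.≟ v') ⊎-dec segmentsSeparated? _ _ _ _

  VertexOff : Fin m → Fin m → Fin m → Set
  VertexOff w u v = w ≢ u → w ≢ v → ¬ OnSegment (pos w) (pos u) (pos v)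

  EdgesOff : Fin m → Fin m → Fin m → Fin m → Set
  EdgesOff u v u' v' = u ≢ u' → u ≢ v' → v ≢ u' → v ≢ v' → ¬ SegmentsMeet (pos u) (pos v) (pos u') (pos v')

  ClearOfVertex⇒VertexOff : ∀ {w u v} → ClearOfVertex w (u , v) → VertexOff w u v
  ClearOfVertex⇒VertexOff (inj₁ w≡u) w≢u _ = ⊥-elim (w≢u w≡u)
  ClearOfVertex⇒VertexOff (inj₂ (inj₁ w≡v)) _ w≢v = ⊥-elim (w≢v w≡v)
  ClearOfVertex⇒VertexOff {w} {u} {v} (inj₂ (inj₂ separated)) _ _ w∈uv =
    SegmentsSeparated⇒¬meet (position u) (position v) (position w) (position w) separated
      (pos w , w∈uv , OnSegment-start (pos w) (pos w))

  ClearOfEdge⇒EdgesOff : ∀ {u v u' v'} → ClearOfEdge (u , v) (u' , v') → EdgesOff u v u' v'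
  ClearOfEdge⇒EdgesOff (inj₁ (inj₁ eq)) ne _ _ _ = ⊥-elim (ne eq)
  ClearOfEdge⇒EdgesOff (inj₁ (inj₂ (inj₁ eq))) _ ne _ _ = ⊥-elim (ne eq)
  ClearOfEdge⇒EdgesOff (inj₁ (inj₂ (inj₂ (inj₁ eq)))) _ _ ne _ = ⊥-elim (ne eq)
  ClearOfEdge⇒EdgesOff (inj₁ (inj₂ (inj₂ (inj₂ eq)))) _ _ _ ne = ⊥-elim (ne eq)
  ClearOfEdge⇒EdgesOff {u} {v} {u'} {v'} (inj₂ separated) _ _ _ _ =
    SegmentsSeparated⇒¬meet (position u) (position v) (position u') (position v') separated

  VertexOff-sym : ∀ {w u v} → VertexOff w u v → VertexOff w v u
  VertexOff-sym {w} {u} {v} off w≢v w≢u = off w≢u w≢v ∘ OnSegment-reverse {p = pos v} {pos u}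

  EdgesOff-symˡ : ∀ {u v u' v'} → EdgesOff u v u' v' → EdgesOff v u u' v'
  EdgesOff-symˡ {u} {v} {u'} {v'} off v≢u' v≢v' u≢u' u≢v' =
    off u≢u' u≢v' v≢u' v≢v' ∘ SegmentsMeet-reverseˡ {pos v} {pos u} {pos u'} {pos v'}

  EdgesOff-symʳ : ∀ {u v u' v'} → EdgesOff u v u' v' → EdgesOff u v v' u'
  EdgesOff-symʳ {u} {v} {u'} {v'} off u≢v' u≢u' v≢v' v≢u' =
    off u≢u' u≢v' v≢u' v≢v' ∘ SegmentsMeet-reverseʳ {pos u} {pos v} {pos v'} {pos u'}

  straightLineDrawing : (∀ u v → position u ≡ position v → u ≡ v) →
                        (∀ w → All (ClearOfVertex w) arcs) →
                        All (λ e → All (ClearOfEdge e) arcs) arcs →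
                        PlanarDrawing D
  straightLineDrawing position-injective vertices-clear edges-clear = record
    { pos       = pos
    ; injective = λ u v pu≡pv → position-injective u v (toPoint-injective pu≡pv)
    ; vertexOff = λ u v w → Edge-elim D VertexOff-sym
                    (ClearOfVertex⇒VertexOff ∘ All.lookup (vertices-clear w) ∘ Arc-listDigraph⇒∈)
    ; disjoint  = λ u v u' v' uv u'v' → edgesOff uv u'v'
    }
    where
    arcsOff : ∀ {u v u' v'} → Arc D u v → Arc D u' v' → EdgesOff u v u' v'
    arcsOff uv u'v' = ClearOfEdge⇒EdgesOff
      (All.lookup (All.lookup edges-clear (Arc-listDigraph⇒∈ uv)) (Arc-listDigraph⇒∈ u'v'))
    edgesOff : ∀ {u v u' v'} → Edge D u v → Edge D u' v' → EdgesOff u v u' v'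
    edgesOff {u' = u'} {v'} uv u'v' =
      Edge-elim D {λ u v → EdgesOff u v u' v'} EdgesOff-symˡ
        (λ a → Edge-elim D EdgesOff-symʳ (arcsOff a) u'v') uv
    toPoint-injective : ∀ {p q} → toPoint p ≡ toPoint q → p ≡ q
    toPoint-injective {_ , _} {_ , _} eq =
      cong₂ _,_ (fromℤ-injective (cong proj₁ eq)) (fromℤ-injective (cong proj₂ eq))

pathArcs : ∀ {m} → Fin m → Fin m → List (Fin m) → List (Fin m × Fin m)
pathArcs first v []       = (v , first) ∷ []
pathArcs first v (w ∷ ws) = (v , w) ∷ pathArcs first w ws

IsCycle : ∀ {m} → (Fin m → Fin m → Set) → Fin m × List (Fin m) → Set
IsCycle R (v , vs) = Unique (v ∷ vs) × PathBack R v v vs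

cycleArcs : ∀ {m} → Fin m × List (Fin m) → List (Fin m × Fin m)
cycleArcs (v , vs) = pathArcs v v vs

IsCycle⇒HasDirectedCycle : ∀ {m} {R : Fin m → Fin m → Set} c → IsCycle R c → HasDirectedCycle R
IsCycle⇒HasDirectedCycle (v , vs) (unique , path) = v , vs , unique , path

pathBack? : ∀ {m} {R : Fin m → Fin m → Set} → Decidable R → ∀ first v vs → Dec (PathBack R first v vs)
pathBack? R? first v [] with R? v first
... | yes r = yes (close r)
... | no ¬r = no λ { (close r) → ¬r r }
pathBack? R? first v (w ∷ ws) with R? v w | pathBack? R? first w ws
... | yes r | yes p = yes (step r p)
... | no ¬r | _     = no λ { (step r _) → ¬r r }
... | yes _ | no ¬p = no λ { (step _ p) → ¬p p }

isCycle? : ∀ {m} {R : Fin m → Fin m → Set} → Decidable R → ∀ c → Dec (IsCycle R c)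
isCycle? R? (v , vs) = Unique.unique? Fin._≟_ (v ∷ vs) ×-dec pathBack? R? v v vs

PathBack-avoiding : ∀ {D F first v vs} → All (_∉ F) (pathArcs first v vs) →
                    PathBack (Arc D) first v vs → PathBack (ArcMinus D F) first v vs
PathBack-avoiding (v∉F ∷ [])  (close r)  = close (r , v∉F)
PathBack-avoiding (v∉F ∷ ∉Fs) (step r p) = step (r , v∉F) (PathBack-avoiding ∉Fs p)

feedbackArcSet-meets-cycle : ∀ {D F} c → IsFeedbackArcSet D F → IsCycle (Arc D) c → Any (_∈ F) (cycleArcs c)
feedbackArcSet-meets-cycle {F = F} (v , vs) (_ , acyclic) (unique , cycle)
  with Any.any? (λ e → Any.any? (e ≟ᵃ_) F) (cycleArcs (v , vs))
... | yes meets = meets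
... | no ¬meets = ⊥-elim (acyclic (v , vs , unique , PathBack-avoiding (AllP.¬Any⇒All¬ _ ¬meets) cycle))

rank-increases-along : ∀ {m} {R : Fin m → Fin m → Set} (rank : Fin m → ℕ) →
                       (∀ {a b} → R a b → rank a ℕ.< rank b) →
                       ∀ {first v vs} → PathBack R first v vs → rank v ℕ.< rank first
rank-increases-along rank increasing (close r)  = increasing r
rank-increases-along rank increasing (step r p) = ℕ.<-trans (increasing r) (rank-increases-along rank increasing p)

ranked⇒acyclic : ∀ {m} {R : Fin m → Fin m → Set} (rank : Fin m → ℕ) →
                 (∀ {a b} → R a b → rank a ℕ.< rank b) → ¬ HasDirectedCycle R
ranked⇒acyclic rank increasing (v , _ , _ , cycle) = ℕ.<-irrefl refl (rank-increases-along rank increasing cycle)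

-- Send each set to the position in F of an element it shares with F: by
-- disjointness this map is injective, so pigeonhole bounds k.
disjoint-hitting-bound : ∀ {A : Set} {k} (F : List A) (G : Fin k → List A) →
                         (∀ i j → i ≢ j → Disjoint (G i) (G j)) →
                         (∀ i → Any (_∈ F) (G i)) → k ℕ.≤ length F
disjoint-hitting-bound F G disjoint hits = ℕ.≮⇒≥ λ |F|<k →
  let i , j , i<j , same-position = Fin.pigeonhole |F|<k (Any.index ∘ witness∈F)
      same-witness = index-injective (setoid _) (witness∈F i) (witness∈F j) same-position
  in disjoint i j (Fin.<⇒≢ i<j) (witness∈G i , subst (_∈ G j) (sym same-witness) (witness∈G j))
  where
  witness∈G : ∀ i → proj₁ (find (hits i)) ∈ G i
  witness∈G i = proj₁ (proj₂ (find (hits i)))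
  witness∈F : ∀ i → proj₁ (find (hits i)) ∈ F
  witness∈F i = proj₂ (proj₂ (find (hits i)))

N : ℕ
N = 15

coreArcs : List (Fin N × Fin N)
coreArcs = (# 0 , # 1) ∷ (# 0 , # 5) ∷ (# 1 , # 2) ∷ (# 2 , # 3) ∷ (# 3 , # 4) ∷ (# 2 , # 0)
         ∷ (# 5 , # 4) ∷ (# 4 , # 0) ∷ (# 5 , # 2) ∷ (# 4 , # 2) ∷ (# 3 , # 1) ∷ (# 3 , # 0) ∷ []

-- (a , x , b) stands for the path a → x → b through a vertex x outside the core 0–5.
twoPaths : List (Fin N × Fin N × Fin N)
twoPaths = (# 0 , # 6 , # 2) ∷ (# 4 , # 7 , # 5) ∷ (# 4 , # 8 , # 5) ∷ (# 0 , # 9 , # 4) ∷ (# 2 , # 10 , # 5)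
         ∷ (# 2 , # 11 , # 5) ∷ (# 2 , # 12 , # 4) ∷ (# 1 , # 13 , # 3) ∷ (# 0 , # 14 , # 3) ∷ []

arcList : List (Fin N × Fin N)
arcList = coreArcs List.++ concatMap (λ (a , x , b) → (a , x) ∷ (x , b) ∷ []) twoPaths

D : Digraph
D = listDigraph N arcList

D-oriented : IsOriented D
D-oriented = from-yes (Fin.all? λ u → ¬? (arc? D u u))
           , from-yes (Fin.all? λ u → Fin.all? λ v → arc? D u v →-dec ¬? (arc? D v u))

position : Fin N → PointZ
position = Vec.lookup
  ( (+ 521 , + 399) ∷ (+ 602 , + 239) ∷ (+ 803 , + 122) ∷ (+ 443 , + 322) ∷ (+ 82 , + 441)
  ∷ (+ 637 , + 443) ∷ (+ 634 , + 230) ∷ (+ 360 , + 538) ∷ (+ 359 , + 548) ∷ (+ 301 , + 407)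
  ∷ (+ 712 , + 279) ∷ (+ 693 , + 269) ∷ (+ 417 , + 227) ∷ (+ 525 , + 287) ∷ (+ 496 , + 346) ∷ [])

D-planar : IsPlanar D
D-planar = straightLineDrawing
  (from-yes (Fin.all? λ u → Fin.all? λ v → ≡-dec ℤ._≟_ ℤ._≟_ (position u) (position v) →-dec u Fin.≟ v))
  (from-yes (Fin.all? λ w → All.all? (clearOfVertex? w) arcList))
  (from-yes (All.all? (λ e → All.all? (clearOfEdge? e) arcList) arcList))
  where open StraightLineDrawing arcList position using (straightLineDrawing; clearOfVertex?; clearOfEdge?)

forced : Fin 7 → Fin N × Fin N
forced = Vec.lookup
  ((# 2 , # 0) ∷ (# 5 , # 4) ∷ (# 4 , # 0) ∷ (# 5 , # 2) ∷ (# 4 , # 2) ∷ (# 3 , # 1) ∷ (# 3 , # 0) ∷ [])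

forcedArcs : List (Fin N × Fin N)
forcedArcs = tabulate forced

-- Core vertex i has rank 10 i, and each path a → x → b climbs; only the forced arcs descend.
rank : Fin N → ℕ
rank = Vec.lookup (0 ∷ 10 ∷ 20 ∷ 30 ∷ 40 ∷ 50 ∷ 5 ∷ 45 ∷ 45 ∷ 5 ∷ 25 ∷ 25 ∷ 25 ∷ 15 ∷ 5 ∷ [])

forcedArcs-feedback : IsFeedbackArcSet D forcedArcs
forcedArcs-feedback =
  ( from-yes (Unique.unique? _≟ᵃ_ forcedArcs)
  , from-yes (All.all? (λ e → arc? D (proj₁ e) (proj₂ e)) forcedArcs) )
  , ranked⇒acyclic rank (λ (uv , uv∉forced) → increasing _ _ uv uv∉forced)
  where
  increasing : ∀ u v → Arc D u v → (u , v) ∉ forcedArcs → rank u ℕ.< rank v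
  increasing = from-yes (Fin.all? λ u → Fin.all? λ v →
    arc? D u v →-dec ¬? (Any.any? ((u , v) ≟ᵃ_) forcedArcs) →-dec rank u ℕ.<? rank v)

apex : Fin 7 → Fin N
apex = Vec.lookup (# 6 ∷ # 7 ∷ # 9 ∷ # 10 ∷ # 12 ∷ # 13 ∷ # 14 ∷ [])

detour : Fin 7 → List (Fin N)
detour = Vec.lookup
  ( (# 1 ∷ []) ∷ (# 8 ∷ []) ∷ (# 1 ∷ # 2 ∷ # 3 ∷ []) ∷ (# 11 ∷ []) ∷ (# 3 ∷ []) ∷ (# 2 ∷ [])
  ∷ (# 1 ∷ # 2 ∷ []) ∷ [])

triangle : Fin 7 → Fin N × List (Fin N)
triangle i = proj₁ (forced i) , proj₂ (forced i) ∷ apex i ∷ []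

detourCycle : Fin 7 → Fin N × List (Fin N)
detourCycle i = proj₁ (forced i) , proj₂ (forced i) ∷ detour i

triangle-isCycle : ∀ i → IsCycle (Arc D) (triangle i)
triangle-isCycle = from-yes (Fin.all? (isCycle? (arc? D) ∘ triangle))

detourCycle-isCycle : ∀ i → IsCycle (Arc D) (detourCycle i)
detourCycle-isCycle = from-yes (Fin.all? (isCycle? (arc? D) ∘ detourCycle))

-- The detour cycle and the triangle of forced i with that arc removed, and the other six
-- triangles: a feedback arc set omitting forced i meets all eight.
obstaclesWithout : Fin 7 → Fin 8 → List (Fin N × Fin N)
obstaclesWithout i zero = List.drop 1 (cycleArcs (detourCycle i))
obstaclesWithout i (suc j) with j Fin.≟ i
... | yes _ = List.drop 1 (cycleArcs (triangle i))
... | no _  = cycleArcs (triangle j)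

obstaclesWithout-disjoint : ∀ i g h → g ≢ h → Disjoint (obstaclesWithout i g) (obstaclesWithout i h)
obstaclesWithout-disjoint = from-yes (Fin.all? λ i → Fin.all? λ g → Fin.all? λ h →
  ¬? (g Fin.≟ h) →-dec disjoint? _≟ᵃ_ (obstaclesWithout i g) (obstaclesWithout i h))

feedbackArcSet-contains-forced : ∀ {F} → IsFeedbackArcSet D F → length F ℕ.≤ 7 → ∀ i → forced i ∈ F
feedbackArcSet-contains-forced {F} fas |F|≤7 i with Any.any? (forced i ≟ᵃ_) F
... | yes forced∈F = forced∈F
... | no forced∉F  = ⊥-elim (ℕ.n≮n 7 (ℕ.≤-trans 8≤|F| |F|≤7))
  where
  meets : ∀ g → Any (_∈ F) (obstaclesWithout i g)
  meets zero = Any.tail forced∉F (feedbackArcSet-meets-cycle (detourCycle i) fas (detourCycle-isCycle i))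
  meets (suc j) with j Fin.≟ i
  ... | yes refl = Any.tail forced∉F (feedbackArcSet-meets-cycle (triangle i) fas (triangle-isCycle i))
  ... | no _     = feedbackArcSet-meets-cycle (triangle j) fas (triangle-isCycle j)
  8≤|F| : 8 ℕ.≤ length F
  8≤|F| = disjoint-hitting-bound F (obstaclesWithout i) (obstaclesWithout-disjoint i) meets

coreTriangles : List (Fin N × List (Fin N))
coreTriangles =
  (# 0 , # 1 ∷ # 2 ∷ []) ∷ (# 0 , # 5 ∷ # 2 ∷ []) ∷ (# 0 , # 5 ∷ # 4 ∷ []) ∷ (# 2 , # 3 ∷ # 4 ∷ []) ∷ []

CoverContainsCoreTriangle : Subset N → Set
CoverContainsCoreTriangle Y = (∀ i → Covers Y (forced i)) → Any (IsCycle (InducedArc D Y)) coreTriangles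

coverContainsCoreTriangle? : ∀ Y → Dec (CoverContainsCoreTriangle Y)
coverContainsCoreTriangle? Y =
  Fin.all? (covers? Y ∘ forced) →-dec Any.any? (isCycle? (inducedArc? D Y)) coreTriangles

-- Only the six core vertices matter, so it suffices to try the 2⁶ subsets of the core.
cover-contains-core-triangle : ∀ Y → CoverContainsCoreTriangle Y
cover-contains-core-triangle Y with Vec.splitAt 6 Y
... | core , rest , refl = decidable-stable (coverContainsCoreTriangle? (core ++ rest)) λ fails →
  from-yes (¬? (anySubset? λ (core′ : Subset 6) → ¬? (coverContainsCoreTriangle? (core′ ++ rest)))) (core , fails)

proposition3p1 : Σ Digraph λ D → IsOriented D × IsPlanar D ×
    ((F : List (ArcPair D)) → IsMinimumFAS D F →
     (Y : Subset (n D)) → IsVertexCover D Y F →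
     HasDirectedCycle (InducedArc D Y))
proposition3p1 = D , D-oriented , D-planar , λ F (fas , minimum) Y cover →
  let forced∈F = feedbackArcSet-contains-forced fas (minimum forcedArcs forcedArcs-feedback)
      c , isCycle = Any.satisfied (cover-contains-core-triangle Y (All.lookup cover ∘ forced∈F))
  in IsCycle⇒HasDirectedCycle c isCycle
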